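{- Let $G$ be a graph and $B\subseteq V(G)$ such that $G-B$ is bipartite with bipartition $(L,R)$ and has a perfect matching $M$. Let $G^*$ be the directed graph defined below. Let $B^*\subseteq B$ be an independent set of $G$, $B':=B\setminus B^*$, and let $C$ be a minimum vertex cut between $B^*_L:=\{x_L:x\in B^*\}$ and $B^*_R:=\{x_R:x\in B^*\}$ in $G^*$. Then there exists a vertex cover $S$ of $G-B'$ of size $|M|+|C|$ which contains every vertex $x\in B^*$ for which $C\cap\{x_L,x_R\}\neq\emptyset$.
   Context: All graphs finite and simple. The directed graph $G^*$ has vertex set $\{x_L,x_R:x\in B\}\cup L\cup R$ (with $x_L,x_R$ new copies of $x\in B$) and arcs: $(x_L,w)$ for $x\in B$, $w\in N_G(x)\cap R$; $(w,x_R)$ for $x\in B$, $w\in N_G(x)\cap L$; $(u_L,v_R)$ and $(v_L,u_R)$ for every edge $\{u,v\}$ of $G$ with $u,v\in B$; $(a,b)$ for every edge $\{a,b\}$ of $G$ with $a\in L$, $b\in R$; and additionally $(b,a)$ for every such edge in $M$. A vertex cut between $P$ and $Q$ in $G^*$ is a set $C\subseteq V(G^*)$ (possibly intersecting $P,Q$) such that $G^*-C$ has no directed path from a vertex of $P\setminus C$ to a vertex of $Q\setminus C$; it is minimum if of minimum cardinality. -}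

module Defs where

open import Data.Nat using (ℕ; _+_; _≤_; _<ᵇ_)
open import Data.Fin using (Fin; toℕ)
open import Data.Fin.Subset using (Subset; _∈_; _∉_; ∣_∣; _∩_; ∁)
open import Data.Bool using (Bool; true; false; if_then_else_; _∧_)
open import Data.List using (map; allFin)
open import Data.Nat.ListAction using (sum)
open import Data.Product using (Σ; _×_; ∃)
open import Data.Sum using (_⊎_)
open import Data.Empty using (⊥)
open import Relation.Nullary using (¬_)
open import Relation.Binary.PropositionalEquality using (_≡_)
open import Relation.Binary.Construct.Closure.ReflexiveTransitive using (Star)

record Graph (n : ℕ) : Set where
  field
    adj        : Fin n → Fin n → Bool
    adj-sym    : ∀ u v → adj u v ≡ adj v u
    adj-irrefl : ∀ v → adj v v ≡ false
open Graph public

Edge : ∀ {n} → Graph n → Fin n → Fin n → Set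
Edge G u v = adj G u v ≡ true

record IsBipartition {n} (G : Graph n) (B L R : Subset n) : Set where
  field
    cover    : ∀ v → v ∈ B ⊎ (v ∈ L ⊎ v ∈ R)
    disj-BL  : ∀ v → v ∈ B → v ∉ L
    disj-BR  : ∀ v → v ∈ B → v ∉ R
    disj-LR  : ∀ v → v ∈ L → v ∉ R
    indep-L  : ∀ u v → u ∈ L → v ∈ L → ¬ Edge G u v
    indep-R  : ∀ u v → u ∈ R → v ∈ R → ¬ Edge G u v

InM : ∀ {n} → (Fin n → Fin n → Bool) → Fin n → Fin n → Set
InM M u v = M u v ≡ true

record IsPerfectMatching {n} (G : Graph n) (B : Subset n) (M : Fin n → Fin n → Bool) : Set where
  field
    M-sym     : ∀ u v → M u v ≡ M v u
    M-edge    : ∀ u v → InM M u v → Edge G u v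
    M-avoidB  : ∀ u v → InM M u v → u ∉ B
    M-unique  : ∀ u v w → InM M u v → InM M u w → v ≡ w
    M-perfect : ∀ v → v ∉ B → ∃ λ u → InM M v u

edgeCount : ∀ {n} → (Fin n → Fin n → Bool) → ℕ
edgeCount {n} M =
  sum (map (λ u → sum (map (λ v → if (toℕ u <ᵇ toℕ v) ∧ M u v then 1 else 0) (allFin n))) (allFin n))

-- Vertices of G*: x_L, x_R (meaningful for x ∈ B) and original vertices (for v ∈ L ∪ R).
data V* (n : ℕ) : Set where
  _ᴸ  : Fin n → V* n
  _ᴿ  : Fin n → V* n
  ⌜_⌝ : Fin n → V* n

record VSet* (n : ℕ) : Set where
  constructor vset
  field
    partL partR partO : Subset n
open VSet* public

_∈*_ : ∀ {n} → V* n → VSet* n → Set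
(x ᴸ) ∈* C = x ∈ partL C
(x ᴿ) ∈* C = x ∈ partR C
⌜ v ⌝ ∈* C = v ∈ partO C

_∉*_ : ∀ {n} → V* n → VSet* n → Set
a ∉* C = ¬ (a ∈* C)

size* : ∀ {n} → VSet* n → ℕ
size* C = ∣ partL C ∣ + ∣ partR C ∣ + ∣ partO C ∣

IsVSubset : ∀ {n} → Subset n → VSet* n → Set
IsVSubset B C = (∀ x → x ∈ partL C → x ∈ B) × (∀ x → x ∈ partR C → x ∈ B)
              × (∀ v → v ∈ partO C → v ∉ B)

module Star-Digraph {n : ℕ} (G : Graph n) (B L R : Subset n) (M : Fin n → Fin n → Bool) where

  data Arc : V* n → V* n → Set where
    xL→w  : ∀ {x w} → x ∈ B → w ∈ R → Edge G x w → Arc (x ᴸ) ⌜ w ⌝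
    w→xR  : ∀ {x w} → x ∈ B → w ∈ L → Edge G x w → Arc ⌜ w ⌝ (x ᴿ)
    uL→vR : ∀ {u v} → u ∈ B → v ∈ B → Edge G u v → Arc (u ᴸ) (v ᴿ)
    a→b   : ∀ {a b} → a ∈ L → b ∈ R → Edge G a b → Arc ⌜ a ⌝ ⌜ b ⌝
    b→a   : ∀ {a b} → a ∈ L → b ∈ R → Edge G a b → InM M a b → Arc ⌜ b ⌝ ⌜ a ⌝

  ArcAvoid : VSet* n → V* n → V* n → Set
  ArcAvoid C a b = Arc a b × a ∉* C × b ∉* C

  IsVertexCut : (P Q : V* n → Set) → VSet* n → Set
  IsVertexCut P Q C = ∀ p q → P p → Q q → p ∉* C → q ∉* C → ¬ Star (ArcAvoid C) p q

  IsMinimumVertexCut : (P Q : V* n → Set) → VSet* n → Set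
  IsMinimumVertexCut P Q C =
    IsVSubset B C × IsVertexCut P Q C
    × (∀ C' → IsVSubset B C' → IsVertexCut P Q C' → size* C ≤ size* C')

_ᴸˢ : ∀ {n} → Subset n → V* n → Set
(X ᴸˢ) (x ᴸ) = x ∈ X
(X ᴸˢ) (x ᴿ) = ⊥
(X ᴸˢ) ⌜ v ⌝ = ⊥

_ᴿˢ : ∀ {n} → Subset n → V* n → Set
(X ᴿˢ) (x ᴸ) = ⊥
(X ᴿˢ) (x ᴿ) = x ∈ X
(X ᴿˢ) ⌜ v ⌝ = ⊥

IsIndependent : ∀ {n} → Graph n → Subset n → Set
IsIndependent G X = ∀ u v → u ∈ X → v ∈ X → ¬ Edge G u v

IsVertexCoverMinus : ∀ {n} → Graph n → (D S : Subset n) → Set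
IsVertexCoverMinus G D S =
  (∀ v → v ∈ S → v ∉ D)
  × (∀ u v → Edge G u v → u ∉ D → v ∉ D → u ∈ S ⊎ v ∈ S)

-- Let Z be the set of vertices of L ∪ R reachable from B*_L in G* − C, and
--   S = {x ∈ B* : x_L ∈ C or x_R ∈ C} ∪ (L − Z) ∪ (R ∩ (Z ∪ C)).
-- S covers G − B′: an edge between x ∈ B* − S and w ∈ L ∩ Z would extend a path of G* − C
-- to x_R, and the remaining edges are handled by the closedness of Z.  Since G* has the arc
-- v → u for every matched edge uv with u ∈ L, such an edge can have both u ∈ L − Z and
-- v ∈ R ∩ (Z ∪ C) only if it meets C, so double counting over M gives |S| ≤ |M| + |C|.  As B*_L is
-- itself a cut, |M| + |C| ≤ |L| + |B*| ≤ |V(G) − B′|, and S is padded with further vertices of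
-- G − B′ to the exact size.
module Submission where

open import Defs
open import Data.Nat using (ℕ; zero; suc; _+_; _*_; _≤_; _<_; z≤n; s≤s; _<ᵇ_)
open import Data.Nat.Properties
open import Data.Fin using (Fin; zero; suc; toℕ)
import Data.Fin.Properties as Fin
open import Data.Fin.Properties using (toℕ-injective)
open import Function using (_∘_; id)
open import Data.Nat.Solver using (module +-*-Solver)
open +-*-Solver using (solve; _:+_; _:=_)
open import Data.Fin.Subset using (Subset; inside; outside; _∈_; _∉_; _⊆_; ∣_∣; _∩_; _∪_; ∁; ⁅_⁆; ⊤)
  renaming (⊥ to ∅)
open import Data.Fin.Subset.Properties
open import Data.Bool using (Bool; true; false; if_then_else_; _∧_)
import Data.Bool as Bool using (_≟_)
open import Data.Vec using ([]; _∷_; lookup; tabulate; here; there)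
open import Data.Vec.Properties using (lookup∘tabulate; []=⇒lookup; lookup⇒[]=)
open import Data.Product using (_×_; ∃; ∃₂; _,_; proj₁; proj₂)
open import Data.Sum using (_⊎_; inj₁; inj₂; [_,_]; swap) renaming (map to ⊎-map)
open import Data.Empty using (⊥-elim)
open import Relation.Nullary using (¬?; Dec; yes; no; does; contradiction; _×-dec_)
open import Relation.Nullary.Decidable using (dec-true; map′; _⊎-dec_)
open import Relation.Unary using (Pred; Decidable)
open import Relation.Binary using (Rel) renaming (Decidable to Decidable₂)
open import Relation.Binary.Construct.Closure.ReflexiveTransitive using (Star; ε; _◅_; _◅◅_; gmap)
open import Level using (_⊔_)
import Data.List as List using (map; allFin; tabulate)
import Data.Nat.ListAction as List using (sum)
open import Data.List.Properties using (map-tabulate)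
open import Relation.Binary.PropositionalEquality
  using (_≡_; _≢_; refl; sym; trans; cong; cong₂; subst; module ≡-Reasoning)
open import Algebra.Properties.Semiring.Sum +-*-semiring
  using (sum; ∑-distrib-+; ∑-comm; sum-cong-≗; *-distribˡ-sum; *-distribʳ-sum)

𝟙 : Bool → ℕ
𝟙 b = if b then 1 else 0

𝟙≤1 : ∀ b → 𝟙 b ≤ 1
𝟙≤1 true  = ≤-refl
𝟙≤1 false = z≤n

𝟙-∧ : ∀ a b → 𝟙 (a ∧ b) ≡ 𝟙 a * 𝟙 b
𝟙-∧ true  b = sym (+-identityʳ (𝟙 b))
𝟙-∧ false b = refl

sum-mono-≤ : ∀ {n} {f g : Fin n → ℕ} → (∀ i → f i ≤ g i) → sum f ≤ sum g
sum-mono-≤ {zero}  f≤g = z≤n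
sum-mono-≤ {suc n} f≤g = +-mono-≤ (f≤g zero) (sum-mono-≤ (f≤g ∘ suc))

sum-single : ∀ {n} {f : Fin n → ℕ} i → (∀ j → j ≢ i → f j ≡ 0) → sum f ≡ f i
sum-single {suc n} {f} zero    others = begin
  f zero + sum (f ∘ suc) ≡⟨ cong (f zero +_) (sum-zero (λ j → others (suc j) λ ())) ⟩
  f zero + 0             ≡⟨ +-identityʳ (f zero) ⟩
  f zero                 ∎
  where open ≡-Reasoning
        sum-zero : ∀ {m} {g : Fin m → ℕ} → (∀ j → g j ≡ 0) → sum g ≡ 0
        sum-zero {zero} _ = refl
        sum-zero {suc m} g≡0 = cong₂ _+_ (g≡0 zero) (sum-zero (g≡0 ∘ suc))
sum-single {suc n} {f} (suc i) others =
  cong₂ _+_ (others zero λ ()) (sum-single i λ j j≢i → others (suc j) (j≢i ∘ Fin.suc-injective))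

halve : ∀ {a b} → a + a ≡ b + b → a ≡ b
halve {a} {b} a+a≡b+b = *-cancelˡ-≡ a b 2 (begin
  2 * a       ≡⟨ cong (a +_) (+-identityʳ a) ⟩
  a + a       ≡⟨ a+a≡b+b ⟩
  b + b       ≡⟨ cong (b +_) (+-identityʳ b) ⟨
  2 * b       ∎)
  where open ≡-Reasoning

sum²-cong-symmetrised : ∀ {n} (f g : Fin n → Fin n → ℕ) → (∀ i j → f i j + f j i ≡ g i j + g j i)
                      → sum (λ i → sum (f i)) ≡ sum (λ i → sum (g i))
sum²-cong-symmetrised f g f+fᵀ≡g+gᵀ = halve (begin
  ∑f + ∑f                                    ≡⟨ cong (∑f +_) (∑-comm f) ⟩
  ∑f + sum (λ j → sum (λ i → f i j))         ≡⟨ symmetrise f ⟨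
  sum (λ i → sum (λ j → f i j + f j i))      ≡⟨ sum-cong-≗ (λ i → sum-cong-≗ (f+fᵀ≡g+gᵀ i)) ⟩
  sum (λ i → sum (λ j → g i j + g j i))      ≡⟨ symmetrise g ⟩
  ∑g + sum (λ j → sum (λ i → g i j))         ≡⟨ cong (∑g +_) (∑-comm g) ⟨
  ∑g + ∑g                                    ∎)
  where
  open ≡-Reasoning
  ∑f = sum (λ i → sum (f i))
  ∑g = sum (λ i → sum (g i))
  symmetrise : ∀ h → sum (λ i → sum (λ j → h i j + h j i)) ≡ sum (λ i → sum (h i)) + sum (λ j → sum (λ i → h i j))
  symmetrise h = trans (sum-cong-≗ (λ i → ∑-distrib-+ (h i) (λ j → h j i)))
                       (∑-distrib-+ (λ i → sum (h i)) (λ i → sum (λ j → h j i)))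

𝟙-<ᵇ-total : ∀ {m n} → m ≢ n → 𝟙 (m <ᵇ n) + 𝟙 (n <ᵇ m) ≡ 1
𝟙-<ᵇ-total {zero}  {zero}  m≢n = contradiction refl m≢n
𝟙-<ᵇ-total {zero}  {suc n} _   = refl
𝟙-<ᵇ-total {suc m} {zero}  _   = refl
𝟙-<ᵇ-total {suc m} {suc n} m≢n = 𝟙-<ᵇ-total (m≢n ∘ cong suc)

*𝟙≡𝟙 : ∀ a b → (b ≡ true → a ≡ 1) → a * 𝟙 b ≡ 𝟙 b
*𝟙≡𝟙 a true  a≡1 = trans (*-identityʳ a) (a≡1 refl)
*𝟙≡𝟙 a false _   = *-zeroʳ a

sum-allFin : ∀ {n} (f : Fin n → ℕ) → List.sum (List.map f (List.allFin n)) ≡ sum f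
sum-allFin f = trans (cong List.sum (map-tabulate (λ i → i) f)) (sum-tabulate f)
  where
  sum-tabulate : ∀ {n} (g : Fin n → ℕ) → List.sum (List.tabulate g) ≡ sum g
  sum-tabulate {zero}  g = refl
  sum-tabulate {suc n} g = cong (g zero +_) (sum-tabulate (g ∘ suc))

χ : ∀ {n} → Subset n → Fin n → ℕ
χ p i = 𝟙 (lookup p i)

χ-∈ : ∀ {n} {p : Subset n} {i} → i ∈ p → χ p i ≡ 1
χ-∈ i∈p rewrite []=⇒lookup i∈p = refl

χ-∉ : ∀ {n} {p : Subset n} {i} → i ∉ p → χ p i ≡ 0
χ-∉ {p = p} {i} i∉p with lookup p i in eq
... | true  = contradiction (lookup⇒[]= i p eq) i∉p
... | false = refl

χ≤1 : ∀ {n} (p : Subset n) i → χ p i ≤ 1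
χ≤1 p i = 𝟙≤1 (lookup p i)

χ-∩ : ∀ {n} (p q : Subset n) i → χ (p ∩ q) i ≡ χ p i * χ q i
χ-∩ (x ∷ p) (y ∷ q) zero    = 𝟙-∧ x y
χ-∩ (x ∷ p) (y ∷ q) (suc i) = χ-∩ p q i

∣p∣≡sum-χ : ∀ {n} (p : Subset n) → ∣ p ∣ ≡ sum (χ p)
∣p∣≡sum-χ []            = refl
∣p∣≡sum-χ (inside  ∷ p) = cong suc (∣p∣≡sum-χ p)
∣p∣≡sum-χ (outside ∷ p) = ∣p∣≡sum-χ p

∣p∪q∣≤∣p∣+∣q∣ : ∀ {n} (p q : Subset n) → ∣ p ∪ q ∣ ≤ ∣ p ∣ + ∣ q ∣
∣p∪q∣≤∣p∣+∣q∣ []            []            = z≤n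
∣p∪q∣≤∣p∣+∣q∣ (inside  ∷ p) (y       ∷ q) = s≤s (≤-trans (∣p∪q∣≤∣p∣+∣q∣ p q) (+-monoʳ-≤ ∣ p ∣ (∣p∣≤∣x∷p∣ y q)))
∣p∪q∣≤∣p∣+∣q∣ (outside ∷ p) (inside  ∷ q) = ≤-trans (s≤s (∣p∪q∣≤∣p∣+∣q∣ p q)) (≤-reflexive (sym (+-suc ∣ p ∣ ∣ q ∣)))
∣p∪q∣≤∣p∣+∣q∣ (outside ∷ p) (outside ∷ q) = ∣p∪q∣≤∣p∣+∣q∣ p q

disjoint⇒∣p∪q∣≡∣p∣+∣q∣ : ∀ {n} {p q : Subset n} → (∀ {i} → i ∈ p → i ∉ q) → ∣ p ∪ q ∣ ≡ ∣ p ∣ + ∣ q ∣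
disjoint⇒∣p∪q∣≡∣p∣+∣q∣ {p = []}          {[]}          _ = refl
disjoint⇒∣p∪q∣≡∣p∣+∣q∣ {p = inside  ∷ p} {inside  ∷ q} disj = contradiction here (disj here)
disjoint⇒∣p∪q∣≡∣p∣+∣q∣ {p = inside  ∷ p} {outside ∷ q} disj =
  cong suc (disjoint⇒∣p∪q∣≡∣p∣+∣q∣ (λ i∈p i∈q → disj (there i∈p) (there i∈q)))
disjoint⇒∣p∪q∣≡∣p∣+∣q∣ {p = outside ∷ p} {inside  ∷ q} disj =
  trans (cong suc (disjoint⇒∣p∪q∣≡∣p∣+∣q∣ (λ i∈p i∈q → disj (there i∈p) (there i∈q)))) (sym (+-suc ∣ p ∣ ∣ q ∣))
disjoint⇒∣p∪q∣≡∣p∣+∣q∣ {p = outside ∷ p} {outside ∷ q} disj =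
  disjoint⇒∣p∪q∣≡∣p∣+∣q∣ (λ i∈p i∈q → disj (there i∈p) (there i∈q))

disjoint⇒∣p∣+∣q∣≤∣r∣ : ∀ {n} {p q r : Subset n} → (∀ {i} → i ∈ p → i ∉ q) → p ⊆ r → q ⊆ r
                      → ∣ p ∣ + ∣ q ∣ ≤ ∣ r ∣
disjoint⇒∣p∣+∣q∣≤∣r∣ {p = p} {q} {r} disj p⊆r q⊆r = begin
  ∣ p ∣ + ∣ q ∣ ≡⟨ disjoint⇒∣p∪q∣≡∣p∣+∣q∣ disj ⟨
  ∣ p ∪ q ∣     ≤⟨ p⊆q⇒∣p∣≤∣q∣ (λ {i} i∈p∪q → [ p⊆r , q⊆r ] (x∈p∪q⁻ p q i∈p∪q)) ⟩
  ∣ r ∣         ∎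
  where open ≤-Reasoning

⟦_⟧ : ∀ {n ℓ} {P : Pred (Fin n) ℓ} → Decidable P → Subset n
⟦ P? ⟧ = tabulate (does ∘ P?)

∈⟦⟧⁺ : ∀ {n ℓ} {P : Pred (Fin n) ℓ} (P? : Decidable P) {i} → P i → i ∈ ⟦ P? ⟧
∈⟦⟧⁺ P? {i} Pi = lookup⇒[]= i _ (trans (lookup∘tabulate (does ∘ P?) i) (dec-true (P? i) Pi))

∈⟦⟧⁻ : ∀ {n ℓ} {P : Pred (Fin n) ℓ} (P? : Decidable P) {i} → i ∈ ⟦ P? ⟧ → P i
∈⟦⟧⁻ P? {i} i∈ with P? i | trans (sym (lookup∘tabulate (does ∘ P?) i)) ([]=⇒lookup i∈)
... | yes Pi | _  = Pi
... | no  _  | ()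

⊆-interpolate : ∀ {n} {p q : Subset n} k → p ⊆ q → ∣ p ∣ ≤ k → k ≤ ∣ q ∣
              → ∃ λ s → p ⊆ s × s ⊆ q × ∣ s ∣ ≡ k
⊆-interpolate {p = []} {[]} zero _ _ _ = [] , (λ ()) , (λ ()) , refl
⊆-interpolate {p = inside ∷ p} {outside ∷ q} k p⊆q _ _ = contradiction (p⊆q here) λ ()
⊆-interpolate {p = inside ∷ p} {inside ∷ q} (suc k) p⊆q (s≤s ∣p∣≤k) (s≤s k≤∣q∣)
  with s , p⊆s , s⊆q , ∣s∣≡k ← ⊆-interpolate k (drop-∷-⊆ p⊆q) ∣p∣≤k k≤∣q∣
  = inside ∷ s , s⊆s p⊆s , s⊆s s⊆q , cong suc ∣s∣≡k
⊆-interpolate {p = outside ∷ p} {outside ∷ q} k p⊆q ∣p∣≤k k≤∣q∣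
  with s , p⊆s , s⊆q , ∣s∣≡k ← ⊆-interpolate k (drop-∷-⊆ p⊆q) ∣p∣≤k k≤∣q∣
  = outside ∷ s , s⊆s p⊆s , s⊆s s⊆q , ∣s∣≡k
⊆-interpolate {p = outside ∷ p} {inside ∷ q} k p⊆q ∣p∣≤k k≤1+∣q∣ with m≤n⇒m<n∨m≡n k≤1+∣q∣
... | inj₁ (s≤s k≤∣q∣)
  with s , p⊆s , s⊆q , ∣s∣≡k ← ⊆-interpolate k (drop-∷-⊆ p⊆q) ∣p∣≤k k≤∣q∣
  = outside ∷ s , s⊆s p⊆s , out⊆ s⊆q , ∣s∣≡k
... | inj₂ refl
  with s , p⊆s , s⊆q , ∣s∣≡∣q∣ ← ⊆-interpolate ∣ q ∣ (drop-∷-⊆ p⊆q) (p⊆q⇒∣p∣≤∣q∣ (drop-∷-⊆ p⊆q)) ≤-refl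
  = inside ∷ s , out⊆ p⊆s , s⊆s s⊆q , cong suc ∣s∣≡∣q∣

record ReachableSet {n ℓ ℓ′} (E : Rel (Fin n) ℓ) (P : Pred (Fin n) ℓ′) : Set (ℓ ⊔ ℓ′) where
  field
    members   : Subset n
    seeds     : ∀ {v} → P v → v ∈ members
    closed    : ∀ {v w} → v ∈ members → E v w → w ∈ members
    reachable : ∀ {w} → w ∈ members → ∃ λ v → P v × Star E v w

module _ {n ℓ ℓ′} {E : Rel (Fin n) ℓ} {P : Pred (Fin n) ℓ′} (E? : Decidable₂ E) (P? : Decidable P) where

  private
    Invariant : Subset n → Set (ℓ ⊔ ℓ′)
    Invariant Z = (∀ {v} → P v → v ∈ Z) × (∀ {w} → w ∈ Z → ∃ λ v → P v × Star E v w)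

    Leak : Subset n → Fin n → Fin n → Set ℓ
    Leak Z v w = v ∈ Z × E v w × w ∉ Z

    leak? : ∀ Z → Dec (∃₂ (Leak Z))
    leak? Z = Fin.any? λ v → Fin.any? λ w → (v ∈? Z) ×-dec E? v w ×-dec ¬? (w ∈? Z)

    -- `fuel` bounds how often Z can still grow: each step adds a new element.
    grow : ∀ fuel Z → n ≤ fuel + ∣ Z ∣ → Invariant Z → ReachableSet E P
    grow fuel Z n≤fuel+∣Z∣ (seeds , reachable) with leak? Z
    ... | no noLeak = record { members = Z ; seeds = seeds ; closed = closed ; reachable = reachable }
      where
      closed : ∀ {v w} → v ∈ Z → E v w → w ∈ Z
      closed {v} {w} v∈Z e with w ∈? Z
      ... | yes w∈Z = w∈Z
      ... | no  w∉Z = contradiction (v , w , v∈Z , e , w∉Z) noLeak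
    ... | yes (v , w , v∈Z , e , w∉Z) = grow′ fuel n≤fuel+∣Z∣
      where
      Z′ = Z ∪ ⁅ w ⁆
      ∣Z∣<∣Z′∣ : ∣ Z ∣ < ∣ Z′ ∣
      ∣Z∣<∣Z′∣ = p⊂q⇒∣p∣<∣q∣ (p⊆p∪q ⁅ w ⁆ , w , x∈p∪q⁺ (inj₂ (x∈⁅x⁆ w)) , w∉Z)
      reachable′ : ∀ {u} → u ∈ Z′ → ∃ λ s → P s × Star E s u
      reachable′ {u} u∈Z′ with x∈p∪q⁻ Z ⁅ w ⁆ u∈Z′
      ... | inj₁ u∈Z = reachable u∈Z
      ... | inj₂ u∈⁅w⁆ rewrite x∈⁅y⁆⇒x≡y w u∈⁅w⁆ with s , Ps , path ← reachable v∈Z = s , Ps , path ◅◅ (e ◅ ε)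
      grow′ : ∀ k → n ≤ k + ∣ Z ∣ → ReachableSet E P
      grow′ zero    n≤∣Z∣   = contradiction (≤-trans (∣p∣≤n Z′) n≤∣Z∣) (<⇒≱ ∣Z∣<∣Z′∣)
      grow′ (suc k) n≤1+k+∣Z∣ =
        grow k Z′ (≤-trans n≤1+k+∣Z∣ (subst (_≤ k + ∣ Z′ ∣) (+-suc k ∣ Z ∣) (+-monoʳ-≤ k ∣Z∣<∣Z′∣)))
             ((λ Pv → p⊆p∪q ⁅ w ⁆ (seeds Pv)) , reachable′)

  reachableSet : ReachableSet E P
  reachableSet = grow n ⟦ P? ⟧ (m≤m+n n _) (∈⟦⟧⁺ P? , λ {w} w∈ → w , ∈⟦⟧⁻ P? w∈ , ε)

enlarge-vertexCover : ∀ {n} {G : Graph n} {D S : Subset n} k → IsVertexCoverMinus G D S → ∣ S ∣ ≤ k → k ≤ ∣ ∁ D ∣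
                    → ∃ λ S′ → S ⊆ S′ × IsVertexCoverMinus G D S′ × ∣ S′ ∣ ≡ k
enlarge-vertexCover k (S-avoids-D , S-covers) ∣S∣≤k k≤∣∁D∣ =
  let S′ , S⊆S′ , S′⊆∁D , ∣S′∣≡k = ⊆-interpolate k (x∉p⇒x∈∁p ∘ S-avoids-D _) ∣S∣≤k k≤∣∁D∣
  in  S′ , S⊆S′ , ((λ v → x∈∁p⇒x∉p ∘ S′⊆∁D) , λ u v e u∉D v∉D → ⊎-map S⊆S′ S⊆S′ (S-covers u v e u∉D v∉D))
         , ∣S′∣≡k

module PerfectMatching {n} {G : Graph n} {B L R : Subset n} {M : Fin n → Fin n → Bool}
                       (bip : IsBipartition G B L R) (pm : IsPerfectMatching G B M) where
  open IsBipartition bip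
  open IsPerfectMatching pm

  matched-L⇒R : ∀ {u v} → u ∈ L → InM M u v → v ∈ R
  matched-L⇒R {u} {v} u∈L uMv with cover v
  ... | inj₁ v∈B        = contradiction v∈B (M-avoidB v u (trans (M-sym v u) uMv))
  ... | inj₂ (inj₁ v∈L) = contradiction (M-edge u v uMv) (indep-L u v u∈L v∈L)
  ... | inj₂ (inj₂ v∈R) = v∈R

  matched-R⇒L : ∀ {u v} → v ∈ R → InM M u v → u ∈ L
  matched-R⇒L {u} {v} v∈R uMv with cover u
  ... | inj₁ u∈B        = contradiction u∈B (M-avoidB u v uMv)
  ... | inj₂ (inj₁ u∈L) = u∈L
  ... | inj₂ (inj₂ u∈R) = contradiction (M-edge u v uMv) (indep-R u v u∈R v∈R)

  χL+χR≡1 : ∀ {u} → u ∉ B → χ L u + χ R u ≡ 1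
  χL+χR≡1 {u} u∉B with cover u
  ... | inj₁ u∈B        = contradiction u∈B u∉B
  ... | inj₂ (inj₁ u∈L) = cong₂ _+_ (χ-∈ u∈L) (χ-∉ (disj-LR u u∈L))
  ... | inj₂ (inj₂ u∈R) = cong₂ _+_ (χ-∉ (λ u∈L → disj-LR u u∈L u∈R)) (χ-∈ u∈R)

  degree≡1 : ∀ {u} → u ∉ B → sum (λ v → 𝟙 (M u v)) ≡ 1
  degree≡1 {u} u∉B with v , uMv ← M-perfect u u∉B = trans (sum-single v unmatched) (cong 𝟙 uMv)
    where
    unmatched : ∀ w → w ≢ v → 𝟙 (M u w) ≡ 0
    unmatched w w≢v with M u w in uMw
    ... | true  = contradiction (M-unique u w v uMw uMv) w≢v
    ... | false = refl

  χ*degree≡χ : ∀ {X : Subset n} → (∀ {u} → u ∈ X → u ∉ B) → ∀ u → χ X u * sum (λ v → 𝟙 (M u v)) ≡ χ X u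
  χ*degree≡χ {X} X∩B≡∅ u with u ∈? X
  ... | yes u∈X = trans (cong (χ X u *_) (degree≡1 (X∩B≡∅ u∈X))) (*-identityʳ (χ X u))
  ... | no  u∉X rewrite χ-∉ u∉X = refl

  μ : Fin n → Fin n → ℕ
  μ u v = χ L u * 𝟙 (M u v)

  μ-transpose : ∀ u v → μ u v ≡ χ R v * 𝟙 (M v u)
  μ-transpose u v rewrite M-sym v u with M u v in uMv
  ... | false = trans (*-zeroʳ (χ L u)) (sym (*-zeroʳ (χ R v)))
  ... | true with u ∈? L
  ...   | yes u∈L = cong (_* 1) (trans (χ-∈ u∈L) (sym (χ-∈ (matched-L⇒R u∈L uMv))))
  ...   | no  u∉L = cong (_* 1) (trans (χ-∉ u∉L) (sym (χ-∉ (u∉L ∘ λ v∈R → matched-R⇒L v∈R uMv))))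

  μ-row-sum : ∀ u → sum (μ u) ≡ χ L u
  μ-row-sum u = trans (sym (*-distribˡ-sum (χ L u) (λ v → 𝟙 (M u v))))
                      (χ*degree≡χ (λ {u} u∈L u∈B → disj-BL u u∈B u∈L) u)

  μ-column-sum : ∀ v → sum (λ u → μ u v) ≡ χ R v
  μ-column-sum v = begin
    sum (λ u → μ u v)                ≡⟨ sum-cong-≗ (λ u → μ-transpose u v) ⟩
    sum (λ u → χ R v * 𝟙 (M v u))    ≡⟨ *-distribˡ-sum (χ R v) (λ u → 𝟙 (M v u)) ⟨
    χ R v * sum (λ u → 𝟙 (M v u))    ≡⟨ χ*degree≡χ (λ {v} v∈R v∈B → disj-BR v v∈B v∈R) v ⟩
    χ R v                            ∎
    where open ≡-Reasoning

  sum-μ-left : ∀ (f : Fin n → ℕ) → sum (λ u → sum (λ v → μ u v * f u)) ≡ sum (λ u → χ L u * f u)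
  sum-μ-left f = sum-cong-≗ λ u → trans (sym (*-distribʳ-sum (f u) (μ u))) (cong (_* f u) (μ-row-sum u))

  sum-μ-right : ∀ (f : Fin n → ℕ) → sum (λ u → sum (λ v → μ u v * f v)) ≡ sum (λ v → χ R v * f v)
  sum-μ-right f = trans (∑-comm (λ u v → μ u v * f v)) (sum-cong-≗ λ v →
    trans (sym (*-distribʳ-sum (f v) (λ u → μ u v))) (cong (_* f v) (μ-column-sum v)))

  μ-symmetrised : ∀ u v → μ u v + μ v u ≡ 𝟙 (M u v)
  μ-symmetrised u v = begin
    χ L u * 𝟙 (M u v) + μ v u               ≡⟨ cong (χ L u * 𝟙 (M u v) +_) (μ-transpose v u) ⟩
    χ L u * 𝟙 (M u v) + χ R u * 𝟙 (M u v)   ≡⟨ *-distribʳ-+ (𝟙 (M u v)) (χ L u) (χ R u) ⟨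
    (χ L u + χ R u) * 𝟙 (M u v)             ≡⟨ *𝟙≡𝟙 _ (M u v) (λ uMv → χL+χR≡1 (M-avoidB u v uMv)) ⟩
    𝟙 (M u v)                               ∎
    where open ≡-Reasoning

  edgeCount≡∣L∣ : edgeCount M ≡ ∣ L ∣
  edgeCount≡∣L∣ = begin
    edgeCount M                          ≡⟨ sum-allFin (λ u → List.sum (List.map (𝟙 ∘ (u ≺_)) (List.allFin n))) ⟩
    sum (λ u → List.sum (List.map (𝟙 ∘ (u ≺_)) (List.allFin n)))
                                         ≡⟨ sum-cong-≗ (λ u → sum-allFin (𝟙 ∘ (u ≺_))) ⟩
    sum (λ u → sum (λ v → 𝟙 (u ≺ v)))   ≡⟨ sum²-cong-symmetrised (λ u v → 𝟙 (u ≺ v)) μ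
                                              (λ u v → trans (ordered-symmetrised u v) (sym (μ-symmetrised u v))) ⟩
    sum (λ u → sum (μ u))                ≡⟨ sum-cong-≗ μ-row-sum ⟩
    sum (χ L)                            ≡⟨ ∣p∣≡sum-χ L ⟨
    ∣ L ∣                                ∎
    where
    open ≡-Reasoning
    _≺_ : Fin n → Fin n → Bool
    u ≺ v = (toℕ u <ᵇ toℕ v) ∧ M u v
    loopless : ∀ {u v} → InM M u v → u ≢ v
    loopless {u} uMu refl = contradiction (trans (sym (M-edge u u uMu)) (adj-irrefl G u)) λ ()
    ordered-symmetrised : ∀ u v → 𝟙 (u ≺ v) + 𝟙 (v ≺ u) ≡ 𝟙 (M u v)
    ordered-symmetrised u v = begin
      𝟙 (u ≺ v) + 𝟙 (v ≺ u)                    ≡⟨ cong₂ _+_ (𝟙-∧ (toℕ u <ᵇ toℕ v) (M u v)) (𝟙-∧ (toℕ v <ᵇ toℕ u) (M v u)) ⟩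
      u<v * 𝟙 (M u v) + v<u * 𝟙 (M v u)        ≡⟨ cong (λ m → u<v * 𝟙 (M u v) + v<u * 𝟙 m) (M-sym v u) ⟩
      u<v * 𝟙 (M u v) + v<u * 𝟙 (M u v)        ≡⟨ *-distribʳ-+ (𝟙 (M u v)) u<v v<u ⟨
      (u<v + v<u) * 𝟙 (M u v)                  ≡⟨ *𝟙≡𝟙 _ (M u v) (λ uMv → 𝟙-<ᵇ-total (loopless uMv ∘ toℕ-injective)) ⟩
      𝟙 (M u v)                                ∎
      where
      u<v = 𝟙 (toℕ u <ᵇ toℕ v)
      v<u = 𝟙 (toℕ v <ᵇ toℕ u)

  μ-mono : ∀ {u v a b} → (u ∈ L → InM M u v → a ≤ b) → μ u v * a ≤ μ u v * b
  μ-mono {u} {v} a≤b with u ∈? L | M u v in uMv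
  ... | yes u∈L | true  rewrite χ-∈ u∈L = *-monoʳ-≤ 1 (a≤b u∈L refl)
  ... | yes u∈L | false rewrite *-zeroʳ (χ L u) = z≤n
  ... | no  u∉L | _     rewrite χ-∉ u∉L = z≤n

  sumM : (Fin n → Fin n → ℕ) → ℕ
  sumM h = sum (λ u → sum (λ v → μ u v * h u v))

  sumM-+ : ∀ h h′ → sumM (λ u v → h u v + h′ u v) ≡ sumM h + sumM h′
  sumM-+ h h′ = trans (sum-cong-≗ λ u → trans (sum-cong-≗ λ v → *-distribˡ-+ (μ u v) (h u v) (h′ u v))
                                               (∑-distrib-+ (λ v → μ u v * h u v) (λ v → μ u v * h′ u v)))
                      (∑-distrib-+ (λ u → sum (λ v → μ u v * h u v)) (λ u → sum (λ v → μ u v * h′ u v)))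

  sumM-mono : ∀ {h h′} → (∀ {u v} → u ∈ L → InM M u v → h u v ≤ h′ u v) → sumM h ≤ sumM h′
  sumM-mono h≤h′ = sum-mono-≤ λ u → sum-mono-≤ λ v → μ-mono {u} {v} h≤h′

  ∣L∩X∣≡sumM : ∀ X → ∣ L ∩ X ∣ ≡ sumM (λ u v → χ X u)
  ∣L∩X∣≡sumM X = begin
    ∣ L ∩ X ∣                         ≡⟨ ∣p∣≡sum-χ (L ∩ X) ⟩
    sum (χ (L ∩ X))                   ≡⟨ sum-cong-≗ (χ-∩ L X) ⟩
    sum (λ u → χ L u * χ X u)         ≡⟨ sum-μ-left (χ X) ⟨
    sumM (λ u v → χ X u)              ∎
    where open ≡-Reasoning

  ∣R∩Y∣≡sumM : ∀ Y → ∣ R ∩ Y ∣ ≡ sumM (λ u v → χ Y v)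
  ∣R∩Y∣≡sumM Y = begin
    ∣ R ∩ Y ∣                         ≡⟨ ∣p∣≡sum-χ (R ∩ Y) ⟩
    sum (χ (R ∩ Y))                   ≡⟨ sum-cong-≗ (χ-∩ R Y) ⟩
    sum (λ v → χ R v * χ Y v)         ≡⟨ sum-μ-right (χ Y) ⟨
    sumM (λ u v → χ Y v)              ∎
    where open ≡-Reasoning

  sumM-χ : ∀ X Y → sumM (λ u v → χ X u + χ Y v) ≡ ∣ L ∩ X ∣ + ∣ R ∩ Y ∣
  sumM-χ X Y = trans (sumM-+ (λ u v → χ X u) (λ u v → χ Y v)) (sym (cong₂ _+_ (∣L∩X∣≡sumM X) (∣R∩Y∣≡sumM Y)))

  -- Double counting over the edges of M: an edge uv (u ∈ L) is counted twice on the left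
  -- only if W contains u or v.
  matched-count : ∀ {X Y W : Subset n} → (∀ {u v} → u ∈ L → InM M u v → u ∈ X → v ∈ Y → u ∈ W ⊎ v ∈ W)
                → ∣ L ∩ X ∣ + ∣ R ∩ Y ∣ ≤ ∣ L ∣ + ∣ W ∣
  matched-count {X} {Y} {W} hit = begin
    (∣ L ∩ X ∣) + (∣ R ∩ Y ∣)                 ≡⟨ sumM-χ X Y ⟨
    sumM (λ u v → χ X u + χ Y v)              ≤⟨ sumM-mono (λ u∈L uMv → pair-bound (hit u∈L uMv)) ⟩
    sumM (λ u v → χ ⊤ u + (χ W u + χ W v))    ≡⟨ sumM-+ (λ u v → χ ⊤ u) (λ u v → χ W u + χ W v) ⟩
    sumM (λ u v → χ ⊤ u) + sumM (λ u v → χ W u + χ W v)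
                                              ≡⟨ cong₂ _+_ (∣L∩X∣≡sumM ⊤) (sym (sumM-χ W W)) ⟨
    (∣ L ∩ ⊤ ∣) + (∣ L ∩ W ∣ + ∣ R ∩ W ∣)      ≤⟨ +-mono-≤ (∣p∩q∣≤∣p∣ L ⊤) L∩W+R∩W≤W ⟩
    (∣ L ∣) + (∣ W ∣)                          ∎
    where
    open ≤-Reasoning
    L∩W+R∩W≤W : ∣ L ∩ W ∣ + ∣ R ∩ W ∣ ≤ ∣ W ∣
    L∩W+R∩W≤W = disjoint⇒∣p∣+∣q∣≤∣r∣ L∩W∌R∩W (p∩q⊆q L W) (p∩q⊆q R W)
      where
      L∩W∌R∩W : ∀ {i} → i ∈ L ∩ W → i ∉ R ∩ W
      L∩W∌R∩W {i} i∈L∩W i∈R∩W = disj-LR i (proj₁ (x∈p∩q⁻ L W i∈L∩W)) (proj₁ (x∈p∩q⁻ R W i∈R∩W))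
    pair-bound : ∀ {u v} → (u ∈ X → v ∈ Y → u ∈ W ⊎ v ∈ W) → χ X u + χ Y v ≤ χ ⊤ u + (χ W u + χ W v)
    pair-bound {u} {v} hit′ rewrite χ-∈ (∈⊤ {x = u}) with u ∈? X | v ∈? Y
    ... | no  u∉X | _       rewrite χ-∉ u∉X = ≤-trans (χ≤1 Y v) (m≤m+n 1 _)
    ... | yes _   | no  v∉Y rewrite χ-∉ v∉Y = ≤-trans (≤-reflexive (+-identityʳ (χ X u))) (≤-trans (χ≤1 X u) (m≤m+n 1 _))
    ... | yes u∈X | yes v∈Y rewrite χ-∈ u∈X | χ-∈ v∈Y with hit′ u∈X v∈Y
    ...   | inj₁ u∈W rewrite χ-∈ u∈W = s≤s (s≤s z≤n)
    ...   | inj₂ v∈W rewrite χ-∈ v∈W = s≤s (m≤n+m 1 (χ W u))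

module _ {n} (G : Graph n) (B L R : Subset n) (M : Fin n → Fin n → Bool) where
  open Star-Digraph G B L R M

  edge? : ∀ u v → Dec (Edge G u v)
  edge? u v = adj G u v Bool.≟ true

  _∈*?_ : ∀ a (C : VSet* n) → Dec (a ∈* C)
  (x ᴸ)   ∈*? C = x ∈? partL C
  (x ᴿ)   ∈*? C = x ∈? partR C
  ⌜ v ⌝ ∈*? C = v ∈? partO C

  arc? : ∀ a b → Dec (Arc a b)
  arc? (x ᴸ) (y ᴸ) = no λ ()
  arc? (x ᴸ) (y ᴿ) = map′ (λ (x∈B , y∈B , e) → uL→vR x∈B y∈B e) (λ { (uL→vR x∈B y∈B e) → x∈B , y∈B , e })
                          (x ∈? B ×-dec y ∈? B ×-dec edge? x y)
  arc? (x ᴸ) ⌜ w ⌝ = map′ (λ (x∈B , w∈R , e) → xL→w x∈B w∈R e) (λ { (xL→w x∈B w∈R e) → x∈B , w∈R , e })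
                          (x ∈? B ×-dec w ∈? R ×-dec edge? x w)
  arc? (x ᴿ) _     = no λ ()
  arc? ⌜ w ⌝ (y ᴸ) = no λ ()
  arc? ⌜ w ⌝ (x ᴿ) = map′ (λ (x∈B , w∈L , e) → w→xR x∈B w∈L e) (λ { (w→xR x∈B w∈L e) → x∈B , w∈L , e })
                          (x ∈? B ×-dec w ∈? L ×-dec edge? x w)
  arc? ⌜ a ⌝ ⌜ b ⌝ = map′ [ (λ (a∈L , b∈R , e) → a→b a∈L b∈R e) , (λ (b∈L , a∈R , e , m) → b→a b∈L a∈R e m) ]
                          (λ { (a→b a∈L b∈R e) → inj₁ (a∈L , b∈R , e) ; (b→a b∈L a∈R e m) → inj₂ (b∈L , a∈R , e , m) })
                          ((a ∈? L ×-dec b ∈? R ×-dec edge? a b)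
                           ⊎-dec (b ∈? L ×-dec a ∈? R ×-dec edge? b a ×-dec M b a Bool.≟ true))

  arcAvoid? : ∀ C a b → Dec (ArcAvoid C a b)
  arcAvoid? C a b = arc? a b ×-dec ¬? (a ∈*? C) ×-dec ¬? (b ∈*? C)

  minimum-cut≤∣B*∣ : ∀ {Bs C} → Bs ⊆ B → IsMinimumVertexCut (Bs ᴸˢ) (Bs ᴿˢ) C → size* C ≤ ∣ Bs ∣
  minimum-cut≤∣B*∣ {Bs} {C} Bs⊆B (_ , _ , minimal) =
    ≤-trans (minimal (vset Bs ∅ ∅) ((λ _ → Bs⊆B) , (λ _ x∈∅ → ⊥-elim (∉⊥ x∈∅)) , (λ _ x∈∅ → ⊥-elim (∉⊥ x∈∅)))
                     (λ { (x ᴸ) _ x∈Bs _ xᴸ∉C′ _ _ → xᴸ∉C′ x∈Bs }))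
            (≤-reflexive ∣B*ᴸ∣≡∣B*∣)
    where
    ∣B*ᴸ∣≡∣B*∣ : size* (vset Bs ∅ ∅) ≡ ∣ Bs ∣
    ∣B*ᴸ∣≡∣B*∣ rewrite ∣⊥∣≡0 n = trans (+-identityʳ _) (+-identityʳ _)

  avoiding-path-end : ∀ {C a b} → a ∉* C → Star (ArcAvoid C) a b → b ∉* C
  avoiding-path-end a∉C ε                       = a∉C
  avoiding-path-end _   ((_ , _ , b∉C) ◅ path) = avoiding-path-end b∉C path

module CoverFromCut {n} {G : Graph n} {B L R : Subset n} {M : Fin n → Fin n → Bool}
                    (bip : IsBipartition G B L R) (pm : IsPerfectMatching G B M)
                    {Bs : Subset n} (Bs⊆B : Bs ⊆ B) (Bs-independent : IsIndependent G Bs)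
                    {C : VSet* n} (cut : Star-Digraph.IsVertexCut G B L R M (Bs ᴸˢ) (Bs ᴿˢ) C) where
  open Star-Digraph G B L R M
  open IsBipartition bip
  open IsPerfectMatching pm
  open PerfectMatching bip pm using (matched-L⇒R; matched-count; edgeCount≡∣L∣)

  -- The vertices of L ∪ R reachable in G* − C from B*_L.
  open ReachableSet (reachableSet (λ v w → arcAvoid? G B L R M C ⌜ v ⌝ ⌜ w ⌝)
                                  (λ w → Fin.any? λ x → x ∈? Bs ×-dec arcAvoid? G B L R M C (x ᴸ) ⌜ w ⌝))
    renaming (members to Z; seeds to entry∈Z; closed to Z-closed)

  reached-from-B*ᴸ : ∀ {v} → v ∈ Z → ∃ λ x → x ∈ Bs × (x ᴸ) ∉* C × Star (ArcAvoid C) (x ᴸ) ⌜ v ⌝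
  reached-from-B*ᴸ v∈Z with _ , (x , x∈Bs , entry@(_ , xᴸ∉C , _)) , path ← reachable v∈Z =
    x , x∈Bs , xᴸ∉C , entry ◅ gmap ⌜_⌝ id path

  Z-avoids-C : ∀ {v} → v ∈ Z → v ∉ partO C
  Z-avoids-C v∈Z with _ , _ , xᴸ∉C , path ← reached-from-B*ᴸ v∈Z = avoiding-path-end G B L R M xᴸ∉C path

  S : Subset n
  S = (Bs ∩ (partL C ∪ partR C)) ∪ ((L ∩ ∁ Z) ∪ (R ∩ (Z ∪ partO C)))

  ∈S-cut : ∀ {x} → x ∈ Bs → x ∈ partL C ⊎ x ∈ partR C → x ∈ S
  ∈S-cut x∈Bs x∈C = x∈p∪q⁺ (inj₁ (x∈p∩q⁺ (x∈Bs , x∈p∪q⁺ x∈C)))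

  ∈S-L : ∀ {u} → u ∈ L → u ∉ Z → u ∈ S
  ∈S-L u∈L u∉Z = x∈p∪q⁺ (inj₂ (x∈p∪q⁺ (inj₁ (x∈p∩q⁺ (u∈L , x∉p⇒x∈∁p u∉Z)))))

  ∈S-R : ∀ {v} → v ∈ R → v ∈ Z ⊎ v ∈ partO C → v ∈ S
  ∈S-R v∈R v∈Z∪C = x∈p∪q⁺ (inj₂ (x∈p∪q⁺ (inj₂ (x∈p∩q⁺ (v∈R , x∈p∪q⁺ v∈Z∪C)))))

  covers-B*-R : ∀ {x w} → x ∈ Bs → w ∈ R → Edge G x w → x ∈ S ⊎ w ∈ S
  covers-B*-R {x} {w} x∈Bs w∈R e with x ∈? partL C | w ∈? partO C
  ... | yes x∈C | _       = inj₁ (∈S-cut x∈Bs (inj₁ x∈C))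
  ... | no  _   | yes w∈C = inj₂ (∈S-R w∈R (inj₂ w∈C))
  ... | no  x∉C | no  w∉C = inj₂ (∈S-R w∈R (inj₁ (entry∈Z (x , x∈Bs , xL→w (Bs⊆B x∈Bs) w∈R e , x∉C , w∉C))))

  covers-B*-L : ∀ {x w} → x ∈ Bs → w ∈ L → Edge G x w → x ∈ S ⊎ w ∈ S
  covers-B*-L {x} {w} x∈Bs w∈L e with x ∈? partR C | w ∈? Z
  ... | yes x∈C | _       = inj₁ (∈S-cut x∈Bs (inj₂ x∈C))
  ... | no  _   | no  w∉Z = inj₂ (∈S-L w∈L w∉Z)
  ... | no  x∉C | yes w∈Z with y , y∈Bs , yᴸ∉C , path ← reached-from-B*ᴸ w∈Z =
    contradiction (path ◅◅ ((w→xR (Bs⊆B x∈Bs) w∈L e , Z-avoids-C w∈Z , x∉C) ◅ ε))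
                  (cut (y ᴸ) (x ᴿ) y∈Bs x∈Bs yᴸ∉C x∉C)

  covers-L-R : ∀ {a b} → a ∈ L → b ∈ R → Edge G a b → a ∈ S ⊎ b ∈ S
  covers-L-R {a} {b} a∈L b∈R e with a ∈? Z | b ∈? partO C
  ... | no  a∉Z | _       = inj₁ (∈S-L a∈L a∉Z)
  ... | yes _   | yes b∈C = inj₂ (∈S-R b∈R (inj₂ b∈C))
  ... | yes a∈Z | no  b∉C = inj₂ (∈S-R b∈R (inj₁ (Z-closed a∈Z (a→b a∈L b∈R e , Z-avoids-C a∈Z , b∉C))))

  B′ : Subset n
  B′ = B ∩ ∁ Bs

  outside-B′ : ∀ {u} → u ∉ B′ → u ∈ Bs ⊎ u ∈ L ⊎ u ∈ R
  outside-B′ {u} u∉B′ with cover u | u ∈? Bs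
  ... | inj₂ u∈L∪R | _       = inj₂ u∈L∪R
  ... | inj₁ _     | yes u∈Bs = inj₁ u∈Bs
  ... | inj₁ u∈B   | no  u∉Bs = contradiction (x∈p∩q⁺ (u∈B , x∉p⇒x∈∁p u∉Bs)) u∉B′

  edge-sym : ∀ {u v} → Edge G u v → Edge G v u
  edge-sym {u} {v} e = trans (adj-sym G v u) e

  S-covers : ∀ u v → Edge G u v → u ∉ B′ → v ∉ B′ → u ∈ S ⊎ v ∈ S
  S-covers u v e u∉B′ v∉B′ with outside-B′ u∉B′ | outside-B′ v∉B′
  ... | inj₁ u∈Bs        | inj₁ v∈Bs        = contradiction e (Bs-independent u v u∈Bs v∈Bs)
  ... | inj₁ u∈Bs        | inj₂ (inj₁ v∈L) = covers-B*-L u∈Bs v∈L e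
  ... | inj₁ u∈Bs        | inj₂ (inj₂ v∈R) = covers-B*-R u∈Bs v∈R e
  ... | inj₂ (inj₁ u∈L) | inj₁ v∈Bs        = swap (covers-B*-L v∈Bs u∈L (edge-sym e))
  ... | inj₂ (inj₁ u∈L) | inj₂ (inj₁ v∈L) = contradiction e (indep-L u v u∈L v∈L)
  ... | inj₂ (inj₁ u∈L) | inj₂ (inj₂ v∈R) = covers-L-R u∈L v∈R e
  ... | inj₂ (inj₂ u∈R) | inj₁ v∈Bs        = swap (covers-B*-R v∈Bs u∈R (edge-sym e))
  ... | inj₂ (inj₂ u∈R) | inj₂ (inj₁ v∈L) = swap (covers-L-R v∈L u∈R (edge-sym e))
  ... | inj₂ (inj₂ u∈R) | inj₂ (inj₂ v∈R) = contradiction e (indep-R u v u∈R v∈R)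

  S-avoids-B′ : ∀ v → v ∈ S → v ∉ B′
  S-avoids-B′ v v∈S v∈B′ with x∈p∩q⁻ B (∁ Bs) v∈B′ | x∈p∪q⁻ _ _ v∈S
  ... | _   , v∈∁Bs | inj₁ v∈Bs∩C = x∈∁p⇒x∉p v∈∁Bs (proj₁ (x∈p∩q⁻ Bs _ v∈Bs∩C))
  ... | v∈B , _     | inj₂ v∈L∪R with x∈p∪q⁻ _ _ v∈L∪R
  ...   | inj₁ v∈L∩∁Z = disj-BL v v∈B (proj₁ (x∈p∩q⁻ L _ v∈L∩∁Z))
  ...   | inj₂ v∈R∩Z  = disj-BR v v∈B (proj₁ (x∈p∩q⁻ R _ v∈R∩Z))

  S-isCover : IsVertexCoverMinus G B′ S
  S-isCover = S-avoids-B′ , S-covers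

  ∣S∣≤∣M∣+∣C∣ : ∣ S ∣ ≤ edgeCount M + size* C
  ∣S∣≤∣M∣+∣C∣ = begin
    ∣ S ∣                                      ≤⟨ ∣p∪q∣≤∣p∣+∣q∣ (Bs ∩ (CL ∪ CR)) ((L ∩ ∁ Z) ∪ (R ∩ (Z ∪ CO))) ⟩
    ∣ Bs ∩ (CL ∪ CR) ∣ + ∣ (L ∩ ∁ Z) ∪ (R ∩ (Z ∪ CO)) ∣
                                                ≤⟨ +-mono-≤ (≤-trans (∣p∩q∣≤∣q∣ Bs (CL ∪ CR)) (∣p∪q∣≤∣p∣+∣q∣ CL CR))
                                                            (∣p∪q∣≤∣p∣+∣q∣ (L ∩ ∁ Z) (R ∩ (Z ∪ CO))) ⟩
    (∣ CL ∣ + ∣ CR ∣) + (∣ L ∩ ∁ Z ∣ + ∣ R ∩ (Z ∪ CO) ∣)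
                                                ≤⟨ +-monoʳ-≤ (∣ CL ∣ + ∣ CR ∣) (matched-count unmatched-reach) ⟩
    (∣ CL ∣ + ∣ CR ∣) + (∣ L ∣ + ∣ CO ∣)        ≡⟨ solve 4 (λ a b l c → (a :+ b) :+ (l :+ c) := l :+ ((a :+ b) :+ c)) refl
                                                          (∣ CL ∣) (∣ CR ∣) (∣ L ∣) (∣ CO ∣) ⟩
    ∣ L ∣ + size* C                             ≡⟨ cong (_+ size* C) edgeCount≡∣L∣ ⟨
    edgeCount M + size* C                       ∎
    where
    open ≤-Reasoning
    CL = partL C
    CR = partR C
    CO = partO C
    -- The arc v → u of G* along the matched edge forces u ∈ Z unless u ∈ C.
    unmatched-reach : ∀ {u v} → u ∈ L → InM M u v → u ∈ ∁ Z → v ∈ Z ∪ CO → u ∈ CO ⊎ v ∈ CO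
    unmatched-reach {u} {v} u∈L uMv u∈∁Z v∈Z∪C with x∈p∪q⁻ Z CO v∈Z∪C | u ∈? CO
    ... | inj₂ v∈C | _       = inj₂ v∈C
    ... | inj₁ _   | yes u∈C = inj₁ u∈C
    ... | inj₁ v∈Z | no  u∉C = contradiction (Z-closed v∈Z (arc , Z-avoids-C v∈Z , u∉C)) (x∈∁p⇒x∉p u∈∁Z)
      where arc = b→a u∈L (matched-L⇒R u∈L uMv) (M-edge u v uMv) uMv

  ∣M∣+∣B*∣≤∣∁B′∣ : edgeCount M + ∣ Bs ∣ ≤ ∣ ∁ B′ ∣
  ∣M∣+∣B*∣≤∣∁B′∣ rewrite edgeCount≡∣L∣ = disjoint⇒∣p∣+∣q∣≤∣r∣ L∌Bs L⊆∁B′ Bs⊆∁B′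
    where
    L∌Bs : ∀ {i} → i ∈ L → i ∉ Bs
    L∌Bs {i} i∈L i∈Bs = disj-BL i (Bs⊆B i∈Bs) i∈L
    L⊆∁B′ : L ⊆ ∁ B′
    L⊆∁B′ {i} i∈L = x∉p⇒x∈∁p λ i∈B′ → disj-BL i (proj₁ (x∈p∩q⁻ B (∁ Bs) i∈B′)) i∈L
    Bs⊆∁B′ : Bs ⊆ ∁ B′
    Bs⊆∁B′ {i} i∈Bs = x∉p⇒x∈∁p λ i∈B′ → x∈∁p⇒x∉p (proj₂ (x∈p∩q⁻ B (∁ Bs) i∈B′)) i∈Bs

lemma29 : ∀ {n} (G : Graph n) (B L R : Subset n) (M : Fin n → Fin n → Bool)
          → IsBipartition G B L R → IsPerfectMatching G B M
          → (Bs : Subset n) → Bs ⊆ B → IsIndependent G Bs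
          → (C : VSet* n)
          → Star-Digraph.IsMinimumVertexCut G B L R M (Bs ᴸˢ) (Bs ᴿˢ) C
          → ∃ λ (S : Subset n)
              → IsVertexCoverMinus G (B ∩ ∁ Bs) S
              × ∣ S ∣ ≡ edgeCount M + size* C
              × (∀ x → x ∈ Bs → (x ∈ partL C ⊎ x ∈ partR C) → x ∈ S)
lemma29 G B L R M bip pm Bs Bs⊆B Bs-independent C minC@(_ , cut , _) =
  let S′ , S⊆S′ , S′-isCover , ∣S′∣≡k =
        enlarge-vertexCover {G = G} (edgeCount M + size* C) S-isCover ∣S∣≤∣M∣+∣C∣ k≤∣∁B′∣
  in  S′ , S′-isCover , ∣S′∣≡k , λ x x∈Bs x∈C → S⊆S′ (∈S-cut x∈Bs x∈C)
  where
  open CoverFromCut bip pm Bs⊆B Bs-independent cut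
  k≤∣∁B′∣ : edgeCount M + size* C ≤ ∣ ∁ B′ ∣
  k≤∣∁B′∣ = ≤-trans (+-monoʳ-≤ (edgeCount M) (minimum-cut≤∣B*∣ G B L R M Bs⊆B minC)) ∣M∣+∣B*∣≤∣∁B′∣
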